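{- Let $m>2$ be an integer, $n=3m$, and let $a,b,c$ be integers with $a\equiv b\equiv c\equiv 2\pmod 3$ such that the $n$-tuple $(a,b,c,\,a,b,c,\,\ldots,\,a,b,c)$ (block $(a,b,c)$ repeated $m$ times) represents an $m$-circular $3m$-polygon. Then there are integers $a',b',c'$, all congruent to $1$ mod $3$, such that $(a',b',c',\,a',b',c',\,\ldots,\,a',b',c')$ represents the same polygon.
   Context: Let $V_n=\{v_k=e^{2\pi i k/n}: k=0,\dots,n-1\}\subset\mathbb{C}$. An $n$-polygon is a closed polygonal path visiting every point of $V_n$ exactly once (a Hamiltonian cycle on $V_n$ drawn with straight segments), regarded as a set of segments. An $n$-tuple $(e_1,\dots,e_n)$ with entries in $\{1,\dots,n-1\}$ represents the path starting at $v_0$ and moving successively to $v_{s_1},\dots,v_{s_n}$, where $s_k=e_1+\dots+e_k$ (indices mod $n$); it represents an $n$-polygon iff $n\nmid s_k$ for $1\le k\le n-1$ and $n\mid s_n$. A symmetry axis of an $n$-polygon is a line through $0$ such that reflection in it maps the polygon onto itself. An $m$-circular $3m$-polygon is a $3m$-polygon with no symmetry axis that is mapped onto itself by the rotations about $0$ through the angles $\frac{3\cdot 2\pi i}{n}$, $i=1,\dots,m$. -}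

module Defs where

open import Data.Nat using (ℕ; zero; suc; _+_; _*_; _∸_; _≤_; _<_)
open import Data.Nat.DivMod using (_%_)
open import Data.Nat.Divisibility using (_∣_)
open import Data.Product using (_×_; ∃; Σ)
open import Data.Sum using (_⊎_)
open import Relation.Nullary using (¬_)
open import Relation.Binary.PropositionalEquality using (_≡_)
open import Function.Bundles using (_⇔_)

-- residue of x modulo n (with the convention x mod 0 = x, never used for n > 0)
_mod_ : ℕ → ℕ → ℕ
x mod zero = x
x mod suc k = x % suc k

-- An n-tuple (e_1,…,e_n) is encoded 0-indexed as e : ℕ → ℕ, entries e 0 … e (n-1).
-- partial sums: psum e k = e_1 + … + e_k
psum : (ℕ → ℕ) → ℕ → ℕ
psum e zero = 0
psum e (suc k) = psum e k + e k

Represents : ℕ → (ℕ → ℕ) → Set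
Represents n e =
  (∀ k → k < n → 1 ≤ e k × e k ≤ n ∸ 1)
  × (∀ k → 1 ≤ k → k < n → ¬ (n ∣ psum e k))
  × (n ∣ psum e n)

-- The polygon (as a set of segments) represented by e: the segment between the
-- vertices v_x and v_y (x, y ∈ {0,…,n-1}) belongs to it iff it is one of the steps
-- v_{s_k} → v_{s_{k+1}}, 0 ≤ k < n  (segments are unordered).
Seg : ℕ → (ℕ → ℕ) → ℕ → ℕ → Set
Seg n e x y = ∃ λ k → k < n ×
  ((psum e k mod n ≡ x × psum e (suc k) mod n ≡ y)
   ⊎ (psum e k mod n ≡ y × psum e (suc k) mod n ≡ x))

SamePolygon : ℕ → (ℕ → ℕ) → (ℕ → ℕ) → Set
SamePolygon n e e' = ∀ x y → x < n → y < n → (Seg n e x y ⇔ Seg n e' x y)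

Invariant : ℕ → (ℕ → ℕ) → (ℕ → ℕ) → Set
Invariant n e f = ∀ x y → x < n → y < n → (Seg n e x y ⇔ Seg n e (f x) (f y))

-- reflections of the plane in lines through 0 that map V_n to itself are exactly
-- v_x ↦ v_{t-x}, t = 0,…,n-1
reflection : ℕ → ℕ → ℕ → ℕ
reflection n t x = (t + (n ∸ x)) mod n

rotation : ℕ → ℕ → ℕ → ℕ
rotation n j x = (x + j) mod n

HasSymmetryAxis : ℕ → (ℕ → ℕ) → Set
HasSymmetryAxis n e = ∃ λ t → t < n × Invariant n e (reflection n t)

MCircular : ℕ → (ℕ → ℕ) → Set
MCircular m e =
  Represents (3 * m) e
  × ¬ HasSymmetryAxis (3 * m) e
  × (∀ i → 1 ≤ i → i ≤ m → Invariant (3 * m) e (rotation (3 * m) (3 * i)))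

pick : ℕ → ℕ → ℕ → ℕ → ℕ
pick zero a b c = a
pick (suc zero) a b c = b
pick (suc (suc _)) a b c = c

block : ℕ → ℕ → ℕ → ℕ → ℕ
block a b c k = pick (k % 3) a b c

{-# OPTIONS --safe #-}
-- Read backwards, the polygon walked by (e₁,…,eₙ) is walked by (n−eₙ,…,n−e₁): the k-th
-- vertex of the reversed walk is the (n−k)-th vertex of the original one, so every step
-- of one walk is a step of the other, traversed in the opposite direction. The reversal
-- of the block tuple (a,b,c,…) is the block tuple (n−c,n−b,n−a,…), and since 3 ∣ n the
-- residue 2 of a, b, c turns into the residue 1.
module Submission where

open import Defs
open import Data.Nat using (ℕ; zero; suc; _+_; _*_; _∸_; _<_; _≤_; z≤n; s≤s)
open import Data.Nat.Properties
open import Data.Nat.DivMod using (_%_; [m+n]%n≡m%n; [m+kn]%n≡m%n; m*n%n≡0; m%n<n; %-distribˡ-+)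
open import Data.Nat.Divisibility using (_∣_; divides; m%n≡0⇒n∣m; n∣m⇒m%n≡0)
open import Algebra.Properties.CommutativeSemigroup +-commutativeSemigroup
  using (xy∙z≈xz∙y; xy∙z≈x∙zy; x∙yz≈y∙xz)
open import Data.Product using (_×_; _,_; ∃; proj₁; proj₂)
open import Data.Sum using (_⊎_; inj₁; inj₂)
open import Function.Bundles using (_⇔_; mk⇔; module Equivalence)
open import Relation.Nullary using (¬_)
open import Relation.Binary.PropositionalEquality
  using (_≡_; refl; sym; trans; cong; subst; module ≡-Reasoning)

open ≡-Reasoning

Reverses : ℕ → (ℕ → ℕ) → (ℕ → ℕ) → Set
Reverses n e′ e = ∀ k l → suc (k + l) ≡ n → e′ k + e l ≡ n

Joins : ℕ → ℕ → ℕ → ℕ → Set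
Joins u v x y = (u ≡ x × v ≡ y) ⊎ (u ≡ y × v ≡ x)

joins-swap : ∀ {u v u′ v′ x y} → u′ ≡ v → v′ ≡ u → Joins u v x y → Joins u′ v′ x y
joins-swap refl refl (inj₁ (p , q)) = inj₂ (q , p)
joins-swap refl refl (inj₂ (p , q)) = inj₁ (q , p)

complement : ∀ {k n} → k < n → ∃ λ l → suc (k + l) ≡ n
complement k<n = m≤n⇒∃[o]m+o≡n k<n

complement-< : ∀ {k l n} → suc (k + l) ≡ n → l < n
complement-< {k} {l} eq = ≤-trans (s≤s (m≤n+m l k)) (≤-reflexive eq)

module Reversal {n-1 : ℕ} {e′ e : ℕ → ℕ}
  (rep : Represents (suc n-1) e) (rev : Reverses (suc n-1) e′ e) where

  private
    n : ℕ
    n = suc n-1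

  psum-reverses : ∀ k l → k + l ≡ n → psum e′ k + psum e n ≡ psum e l + k * n
  psum-reverses zero l eq = trans (cong (psum e) (sym eq)) (sym (+-identityʳ (psum e l)))
  psum-reverses (suc k) l eq = begin
    (P + e′ k) + S              ≡⟨ xy∙z≈xz∙y P (e′ k) S ⟩
    (P + S) + e′ k              ≡⟨ cong (_+ e′ k) (psum-reverses k (suc l) (trans (+-suc k l) eq)) ⟩
    ((Q + e l) + K) + e′ k      ≡⟨ xy∙z≈xz∙y (Q + e l) K (e′ k) ⟩
    ((Q + e l) + e′ k) + K      ≡⟨ cong (_+ K) (xy∙z≈x∙zy Q (e l) (e′ k)) ⟩
    (Q + (e′ k + e l)) + K      ≡⟨ cong (λ s → (Q + s) + K) (rev k l eq) ⟩
    (Q + n) + K                 ≡⟨ +-assoc Q n K ⟩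
    Q + (n + K)                 ∎
    where
      P Q S K : ℕ
      P = psum e′ k
      Q = psum e l
      S = psum e n
      K = k * n

  vertex-reverses : ∀ k l → k + l ≡ n → psum e′ k % n ≡ psum e l % n
  vertex-reverses k l eq with proj₂ (proj₂ rep)
  ... | divides q S≡qn = begin
    psum e′ k % n                  ≡⟨ sym ([m+kn]%n≡m%n (psum e′ k) q n) ⟩
    (psum e′ k + q * n) % n        ≡⟨ cong (λ s → (psum e′ k + s) % n) (sym S≡qn) ⟩
    (psum e′ k + psum e n) % n     ≡⟨ cong (_% n) (psum-reverses k l eq) ⟩
    (psum e l + k * n) % n         ≡⟨ [m+kn]%n≡m%n (psum e l) k n ⟩
    psum e l % n                   ∎

  segment-reverses : ∀ k l {x y} → suc (k + l) ≡ n →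
    Joins (psum e l % n) (psum e (suc l) % n) x y ⇔ Joins (psum e′ k % n) (psum e′ (suc k) % n) x y
  segment-reverses k l eq = mk⇔ (joins-swap first last) (joins-swap (sym last) (sym first))
    where
      first : psum e′ k % n ≡ psum e (suc l) % n
      first = vertex-reverses k (suc l) (trans (+-suc k l) eq)
      last : psum e′ (suc k) % n ≡ psum e l % n
      last = vertex-reverses (suc k) l eq

  reversed-step : ∀ k l → suc (k + l) ≡ n → e′ k ≡ n ∸ e l
  reversed-step k l eq = trans (sym (m+n∸n≡m (e′ k) (e l))) (cong (_∸ e l) (rev k l eq))

  steps-in-range : ∀ k → k < n → 1 ≤ e′ k × e′ k ≤ n ∸ 1
  steps-in-range k k<n with complement k<n
  ... | l , eq with proj₁ rep l (complement-< eq)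
  ... | 1≤el , el≤n-1 = subst (λ s → 1 ≤ s × s ≤ n ∸ 1) (sym (reversed-step k l eq))
    (m<n⇒0<n∸m (s≤s el≤n-1) , ∸-monoʳ-≤ n 1≤el)

  no-early-return : ∀ k → 1 ≤ k → k < n → ¬ (n ∣ psum e′ k)
  no-early-return (suc k) _ k<n n∣vk with complement k<n
  ... | l , eq = proj₁ (proj₂ rep) (suc l) (s≤s z≤n) (complement-< eq′) n∣vl
    where
      eq′ : suc (k + suc l) ≡ n
      eq′ = trans (cong suc (+-suc k l)) eq
      n∣vl : n ∣ psum e (suc l)
      n∣vl = m%n≡0⇒n∣m _ n (trans (sym (vertex-reverses (suc k) (suc l) eq′)) (n∣m⇒m%n≡0 _ n n∣vk))

  represents : Represents n e′
  represents = steps-in-range , no-early-return ,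
    m%n≡0⇒n∣m (psum e′ n) n (vertex-reverses n 0 (+-identityʳ n))

  samePolygon : SamePolygon n e e′
  samePolygon x y _ _ = mk⇔ forward backward
    where
      forward : Seg n e x y → Seg n e′ x y
      forward (l , l<n , joins) with complement l<n
      ... | k , eq = k , complement-< eq ,
        Equivalence.to (segment-reverses k l (trans (cong suc (+-comm k l)) eq)) joins

      backward : Seg n e′ x y → Seg n e x y
      backward (k , k<n , joins) with complement k<n
      ... | l , eq = l , complement-< eq , Equivalence.from (segment-reverses k l eq) joins

block-periodic : ∀ a b c k → block a b c (3 + k) ≡ block a b c k
block-periodic a b c k =
  cong (λ r → pick r a b c) (trans (cong (_% 3) (+-comm 3 k)) ([m+n]%n≡m%n k 3))

block-antidiagonal : ∀ {a b c a′ b′ c′ s} → a′ + c ≡ s → b′ + b ≡ s → c′ + a ≡ s →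
  ∀ k l t → suc (k + l) ≡ t * 3 → block a′ b′ c′ k + block a b c l ≡ s
block-antidiagonal _ _ _ k l zero ()
block-antidiagonal {a} {b} {c} {a′} {b′} {c′} ac bb ca (suc (suc (suc k))) l (suc t) eq =
  trans (cong (_+ block a b c l) (block-periodic a′ b′ c′ k))
        (block-antidiagonal ac bb ca k l t (cong (_∸ 3) eq))
block-antidiagonal {a} {b} {c} {a′} {b′} {c′} ac bb ca k (suc (suc (suc l))) (suc t) eq =
  trans (cong (block a′ b′ c′ k +_) (block-periodic a b c l))
        (block-antidiagonal ac bb ca k l t (cong (_∸ 3) (trans (cong suc (sym (x∙yz≈y∙xz k 3 l))) eq)))
block-antidiagonal ac bb ca 0 2 1 refl = ac
block-antidiagonal ac bb ca 1 1 1 refl = bb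
block-antidiagonal ac bb ca 2 0 1 refl = ca
block-antidiagonal _ _ _ 0 0 (suc t) ()
block-antidiagonal _ _ _ 0 1 (suc t) ()
block-antidiagonal _ _ _ 1 0 (suc t) ()
block-antidiagonal _ _ _ 0 2 (suc (suc t)) ()
block-antidiagonal _ _ _ 1 1 (suc (suc t)) ()
block-antidiagonal _ _ _ 2 0 (suc (suc t)) ()
block-antidiagonal _ _ _ 1 2 (suc zero) ()
block-antidiagonal _ _ _ 1 2 (suc (suc t)) ()
block-antidiagonal _ _ _ 2 1 (suc zero) ()
block-antidiagonal _ _ _ 2 1 (suc (suc t)) ()
block-antidiagonal _ _ _ 2 2 (suc zero) ()
block-antidiagonal _ _ _ 2 2 (suc (suc t)) ()

residue-of-complement : ∀ y x → (y + x) % 3 ≡ 0 → x % 3 ≡ 2 → y % 3 ≡ 1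
residue-of-complement y x y+x≡0 x≡2 = r+2≡0⇒r≡1 (m%n<n y 3) (begin
  (y % 3 + 2) % 3       ≡⟨ cong (λ r → (y % 3 + r) % 3) (sym x≡2) ⟩
  (y % 3 + x % 3) % 3   ≡⟨ sym (%-distribˡ-+ y x 3) ⟩
  (y + x) % 3           ≡⟨ y+x≡0 ⟩
  0                     ∎)
  where
    r+2≡0⇒r≡1 : ∀ {r} → r < 3 → (r + 2) % 3 ≡ 0 → r ≡ 1
    r+2≡0⇒r≡1 {1} _ _ = refl
    r+2≡0⇒r≡1 {0} _ ()
    r+2≡0⇒r≡1 {2} _ ()
    r+2≡0⇒r≡1 {suc (suc (suc _))} (s≤s (s≤s (s≤s ()))) _

lemma9 : (m a b c : ℕ) → 2 < m
    → a % 3 ≡ 2 → b % 3 ≡ 2 → c % 3 ≡ 2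
    → MCircular m (block a b c)
    → ∃ λ a' → ∃ λ b' → ∃ λ c' →
        a' % 3 ≡ 1 × b' % 3 ≡ 1 × c' % 3 ≡ 1
        × Represents (3 * m) (block a' b' c')
        × SamePolygon (3 * m) (block a b c) (block a' b' c')
lemma9 m@(suc _) a b c _ a≡2 b≡2 c≡2 (rep , _ , _) =
  N ∸ c , N ∸ b , N ∸ a ,
  reversed-residue c≡2 c≤N , reversed-residue b≡2 b≤N , reversed-residue a≡2 a≤N ,
  Reversal.represents rep reverses , Reversal.samePolygon rep reverses
  where
    N : ℕ
    N = 3 * m

    entry≤N : ∀ k → k < 3 → block a b c k ≤ N
    entry≤N k k<3 = ≤-trans (proj₂ (proj₁ rep k (≤-trans k<3 (m≤m*n 3 m)))) (m∸n≤m N 1)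

    a≤N : a ≤ N
    a≤N = entry≤N 0 (s≤s z≤n)
    b≤N : b ≤ N
    b≤N = entry≤N 1 (s≤s (s≤s z≤n))
    c≤N : c ≤ N
    c≤N = entry≤N 2 ≤-refl

    reversed-residue : ∀ {x} → x % 3 ≡ 2 → x ≤ N → (N ∸ x) % 3 ≡ 1
    reversed-residue {x} x≡2 x≤N = residue-of-complement (N ∸ x) x
      (trans (cong (_% 3) (trans (m∸n+n≡m x≤N) (*-comm 3 m))) (m*n%n≡0 m 3)) x≡2

    reverses : Reverses N (block (N ∸ c) (N ∸ b) (N ∸ a)) (block a b c)
    reverses k l eq = block-antidiagonal (m∸n+n≡m c≤N) (m∸n+n≡m b≤N) (m∸n+n≡m a≤N)
      k l m (trans eq (*-comm 3 m))
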